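{- Let $\eta_k=H_{k-1}$ for $k\ge0$, where $H_m=\sum_{j=1}^m 1/j$ for $m\ge1$ and $H_{ -1}=H_0=0$. Then for all $n\ge0$, \[ \mathcal{E}(\eta)_n:=\sum_{k=0}^n S(n,k)(-1)^k k!\,\eta_k=(-1)^n n+\delta_{n,1}, \] and for all $N\ge0$, \[ \sum_{n=0}^N\binom{N}{n}2^n\,\mathcal{E}(\eta)_n=2N\big(1+(-1)^N\big). \]
   Context: $S(n,k)$ are the Stirling numbers of the second kind, defined by $x^n=\sum_{k=0}^n S(n,k)\,x(x-1)\cdots(x-k+1)$ (with $S(0,0)=1$, $S(n,0)=0$ for $n\ge1$). $\delta_{n,1}$ is the Kronecker symbol. -}

module Defs where

open import Data.Nat as ℕ using (ℕ; zero; suc; _!)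
open import Data.Integer as ℤ using (ℤ; +_)
open import Data.Rational using (ℚ; 0ℚ; 1ℚ; _+_; _*_; -_; _/_)

S : ℕ → ℕ → ℕ
S zero    zero    = 1
S zero    (suc k) = 0
S (suc n) zero    = 0
S (suc n) (suc k) = suc k ℕ.* S n (suc k) ℕ.+ S n k

ι : ℕ → ℚ
ι n = + n / 1

sumTo : ℕ → (ℕ → ℚ) → ℚ
sumTo zero    f = f 0
sumTo (suc n) f = sumTo n f + f (suc n)

sign : ℕ → ℚ
sign zero    = 1ℚ
sign (suc k) = - sign k

H : ℕ → ℚ
H zero    = 0ℚ
H (suc m) = H m + (+ 1 / suc m)

η : ℕ → ℚ
η zero    = 0ℚ
η (suc k) = H k

δ₁ : ℕ → ℚ
δ₁ 1 = 1ℚ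
δ₁ _ = 0ℚ

𝓔η : ℕ → ℚ
𝓔η n = sumTo n (λ k → ι (S n k) * sign k * ι (k !) * η k)

-- Writing wₙ(k) = S(n,k) k!, the recurrence of S gives wₙ₊₁(k+1) = (k+1)(wₙ(k+1) + wₙ(k)),
-- so Σₖ wₙ₊₁(k) fₖ = Σₖ wₙ(k) (k fₖ + (k+1) fₖ₊₁); Pascal's rule likewise turns
-- Σₙ C(N+1,n) fₙ into Σₙ C(N,n) (fₙ + fₙ₊₁). The first step sends (-1)ᵏ to -(-1)ᵏ and
-- (-1)ᵏHₖ to -(-1)ᵏHₖ - (-1)ᵏ, whence Σₖ wₙ(k) (-1)ᵏHₖ = (-1)ⁿ n; it sends (-1)ᵏηₖ to the
-- image of (-1)ᵏHₖ plus δ₀, which gives the first identity. The second follows in the same way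
-- from (-2)ⁿ ↦ -(-2)ⁿ and (-2)ⁿ n ↦ -(-2)ⁿ n - 2 (-2)ⁿ, together with Σₙ C(N,n) 2ⁿ δₙ,₁ = 2N.
module Submission where

open import Defs
open import Data.Nat as ℕ using (ℕ; zero; suc; _^_; _!; s≤s)
import Data.Nat.Properties as ℕ
open import Data.Nat.Combinatorics using (_C_; nCk+nC[k+1]≡[n+1]C[k+1]; k>n⇒nCk≡0; nC1≡n)
import Data.Integer as ℤ
import Data.Integer.Properties as ℤ
open import Data.Rational using (ℚ; 0ℚ; 1ℚ; _+_; _*_; -_; _/_; mkℚ; toℚᵘ)
open import Data.Rational.Properties
  using (toℚᵘ-injective; toℚᵘ-fromℚᵘ; toℚᵘ-homo-+; toℚᵘ-homo-*; normalize-coprime; *-inverseʳ;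
         *-zeroˡ; *-zeroʳ; *-identityˡ; *-identityʳ; +-identityˡ; +-identityʳ; +-assoc; *-assoc; *-comm)
import Data.Rational.Unnormalised as ℚᵘ
import Data.Rational.Unnormalised.Properties as ℚᵘ
open import Data.Nat.Coprimality using (1-coprimeTo) renaming (sym to coprime-sym)
open import Data.Rational.Solver using (module +-*-Solver)
open +-*-Solver using (solve; _:+_; _:*_; :-_; _:=_; con)
open import Data.Product using (_×_; _,_)
open import Relation.Binary.PropositionalEquality using (_≡_; refl; cong; cong₂; sym; trans; module ≡-Reasoning)

ιᵘ : ℕ → ℚᵘ.ℚᵘ
ιᵘ n = ℚᵘ.mkℚᵘ (ℤ.+ n) 0

toℚᵘ-ι : ∀ n → toℚᵘ (ι n) ℚᵘ.≃ ιᵘ n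
toℚᵘ-ι n = toℚᵘ-fromℚᵘ (ιᵘ n)

ι-+ : ∀ m n → ι (m ℕ.+ n) ≡ ι m + ι n
ι-+ m n = toℚᵘ-injective (begin
  toℚᵘ (ι (m ℕ.+ n))         ≈⟨ toℚᵘ-ι (m ℕ.+ n) ⟩
  ιᵘ (m ℕ.+ n)               ≈⟨ ℚᵘ.*≡* ιᵘ-+ ⟩
  ιᵘ m ℚᵘ.+ ιᵘ n             ≈⟨ ℚᵘ.+-cong (toℚᵘ-ι m) (toℚᵘ-ι n) ⟨
  toℚᵘ (ι m) ℚᵘ.+ toℚᵘ (ι n) ≈⟨ toℚᵘ-homo-+ (ι m) (ι n) ⟨
  toℚᵘ (ι m + ι n)           ∎)
  where
  open ℚᵘ.≃-Reasoning
  ιᵘ-+ : ℤ.+ (m ℕ.+ n) ℤ.* ℤ.+ 1 ≡ (ℤ.+ m ℤ.* ℤ.+ 1 ℤ.+ ℤ.+ n ℤ.* ℤ.+ 1) ℤ.* ℤ.+ 1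
  ιᵘ-+ = trans (ℤ.*-identityʳ (ℤ.+ (m ℕ.+ n))) (trans (ℤ.pos-+ m n)
    (sym (trans (ℤ.*-identityʳ _) (cong₂ ℤ._+_ (ℤ.*-identityʳ (ℤ.+ m)) (ℤ.*-identityʳ (ℤ.+ n))))))

ι-* : ∀ m n → ι (m ℕ.* n) ≡ ι m * ι n
ι-* m n = toℚᵘ-injective (begin
  toℚᵘ (ι (m ℕ.* n))         ≈⟨ toℚᵘ-ι (m ℕ.* n) ⟩
  ιᵘ (m ℕ.* n)               ≈⟨ ℚᵘ.*≡* (cong (ℤ._* ℤ.+ 1) (ℤ.pos-* m n)) ⟩
  ιᵘ m ℚᵘ.* ιᵘ n             ≈⟨ ℚᵘ.*-cong (toℚᵘ-ι m) (toℚᵘ-ι n) ⟨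
  toℚᵘ (ι m) ℚᵘ.* toℚᵘ (ι n) ≈⟨ toℚᵘ-homo-* (ι m) (ι n) ⟨
  toℚᵘ (ι m * ι n)           ∎)
  where open ℚᵘ.≃-Reasoning

ι-suc : ∀ n → ι (suc n) ≡ 1ℚ + ι n
ι-suc = ι-+ 1

ι-suc-inverseʳ : ∀ n → ι (suc n) * (ℤ.+ 1 / suc n) ≡ 1ℚ
ι-suc-inverseʳ n = trans (cong₂ _*_ (normalize-coprime (coprime-sym (1-coprimeTo (suc n))))
                                    (normalize-coprime (1-coprimeTo (suc n))))
                         (*-inverseʳ (mkℚ (ℤ.+ suc n) 0 (coprime-sym (1-coprimeTo (suc n)))))

sumTo-cong : ∀ n {f g : ℕ → ℚ} → (∀ k → f k ≡ g k) → sumTo n f ≡ sumTo n g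
sumTo-cong zero    f≡g = f≡g 0
sumTo-cong (suc n) f≡g = cong₂ _+_ (sumTo-cong n f≡g) (f≡g (suc n))

sumTo-+ : ∀ n (f g : ℕ → ℚ) → sumTo n (λ k → f k + g k) ≡ sumTo n f + sumTo n g
sumTo-+ zero    f g = refl
sumTo-+ (suc n) f g = trans (cong (_+ (f (suc n) + g (suc n))) (sumTo-+ n f g))
  (solve 4 (λ a b c d → (a :+ b) :+ (c :+ d) := (a :+ c) :+ (b :+ d)) refl
     (sumTo n f) (sumTo n g) (f (suc n)) (g (suc n)))

sumTo-scale : ∀ n c (f : ℕ → ℚ) → sumTo n (λ k → c * f k) ≡ c * sumTo n f
sumTo-scale zero    c f = refl
sumTo-scale (suc n) c f = trans (cong (_+ c * f (suc n)) (sumTo-scale n c f))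
  (solve 3 (λ c s x → c :* s :+ c :* x := c :* (s :+ x)) refl c (sumTo n f) (f (suc n)))

sumTo-unshift : ∀ n (f : ℕ → ℚ) → sumTo (suc n) f ≡ f 0 + sumTo n (λ k → f (suc k))
sumTo-unshift zero    f = refl
sumTo-unshift (suc n) f = trans (cong (_+ f (suc (suc n))) (sumTo-unshift n f))
  (+-assoc (f 0) (sumTo n (λ k → f (suc k))) (f (suc (suc n))))

weightedSum : (ℕ → ℚ) → ℕ → (ℕ → ℚ) → ℚ
weightedSum w n f = sumTo n (λ k → w k * f k)

δ₀ : ℕ → ℚ
δ₀ zero    = 1ℚ
δ₀ (suc _) = 0ℚ

module _ (w : ℕ → ℚ) where

  weightedSum-cong : ∀ n {f g : ℕ → ℚ} → (∀ k → f k ≡ g k) → weightedSum w n f ≡ weightedSum w n g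
  weightedSum-cong n f≡g = sumTo-cong n (λ k → cong (w k *_) (f≡g k))

  weightedSum-+ : ∀ n (f g : ℕ → ℚ) →
                  weightedSum w n (λ k → f k + g k) ≡ weightedSum w n f + weightedSum w n g
  weightedSum-+ n f g = trans
    (sumTo-cong n (λ k → solve 3 (λ w a b → w :* (a :+ b) := w :* a :+ w :* b) refl (w k) (f k) (g k)))
    (sumTo-+ n _ _)

  weightedSum-scale : ∀ n c (f : ℕ → ℚ) → weightedSum w n (λ k → c * f k) ≡ c * weightedSum w n f
  weightedSum-scale n c f = trans
    (sumTo-cong n (λ k → solve 3 (λ w c a → w :* (c :* a) := c :* (w :* a)) refl (w k) c (f k)))
    (sumTo-scale n c _)

  weightedSum-neg : ∀ n (f : ℕ → ℚ) → weightedSum w n (λ k → - f k) ≡ - weightedSum w n f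
  weightedSum-neg n f = begin
    weightedSum w n (λ k → - f k)         ≡⟨ weightedSum-cong n (λ k → solve 1 (λ a → :- a := con (- 1ℚ) :* a) refl (f k)) ⟩
    weightedSum w n (λ k → - 1ℚ * f k)    ≡⟨ weightedSum-scale n (- 1ℚ) f ⟩
    - 1ℚ * weightedSum w n f              ≡⟨ solve 1 (λ a → con (- 1ℚ) :* a := :- a) refl (weightedSum w n f) ⟩
    - weightedSum w n f                   ∎
    where open ≡-Reasoning

  weightedSum-δ₀ : ∀ n → weightedSum w n δ₀ ≡ w 0
  weightedSum-δ₀ zero    = *-identityʳ (w 0)
  weightedSum-δ₀ (suc n) = trans (cong₂ _+_ (weightedSum-δ₀ n) (*-zeroʳ (w (suc n)))) (+-identityʳ (w 0))

  weightedSum-δ₁ : ∀ n → weightedSum w (suc n) δ₁ ≡ w 1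
  weightedSum-δ₁ zero    = trans (cong₂ _+_ (*-zeroʳ (w 0)) (*-identityʳ (w 1))) (+-identityˡ (w 1))
  weightedSum-δ₁ (suc n) = trans (cong₂ _+_ (weightedSum-δ₁ n) (*-zeroʳ (w (suc (suc n))))) (+-identityʳ (w 1))

weightedSum-pascal : ∀ n (a b w w′ f : ℕ → ℚ) →
  w′ 0 ≡ a 0 * w 0 → (∀ k → w′ (suc k) ≡ a (suc k) * w (suc k) + b k * w k) → w (suc n) ≡ 0ℚ →
  weightedSum w′ (suc n) f ≡ weightedSum w n (λ k → a k * f k + b k * f (suc k))
weightedSum-pascal n a b w w′ f w′₀ w′-suc w-top = begin
  weightedSum w′ (suc n) f                        ≡⟨ sumTo-unshift n (λ k → w′ k * f k) ⟩
  w′ 0 * f 0 + sumTo n (λ k → w′ (suc k) * f (suc k))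
    ≡⟨ cong₂ _+_ (trans (cong (_* f 0) w′₀) (reassoc (a 0) (w 0) (f 0))) (sumTo-cong n split) ⟩
  A 0 + sumTo n (λ k → A (suc k) + B k)          ≡⟨ cong (A 0 +_) (sumTo-+ n (λ k → A (suc k)) B) ⟩
  A 0 + (sumTo n (λ k → A (suc k)) + sumTo n B)  ≡⟨ +-assoc (A 0) _ _ ⟨
  A 0 + sumTo n (λ k → A (suc k)) + sumTo n B    ≡⟨ cong (_+ sumTo n B) (sumTo-unshift n A) ⟨
  sumTo n A + A (suc n) + sumTo n B              ≡⟨ cong (λ x → sumTo n A + x + sumTo n B) A-top ⟩
  sumTo n A + 0ℚ + sumTo n B                     ≡⟨ cong (_+ sumTo n B) (+-identityʳ (sumTo n A)) ⟩
  sumTo n A + sumTo n B                          ≡⟨ sumTo-+ n A B ⟨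
  sumTo n (λ k → A k + B k)                      ≡⟨ sumTo-cong n factor ⟩
  weightedSum w n (λ k → a k * f k + b k * f (suc k)) ∎
  where
  open ≡-Reasoning
  A B : ℕ → ℚ
  A k = w k * (a k * f k)
  B k = w k * (b k * f (suc k))
  reassoc : ∀ x y z → x * y * z ≡ y * (x * z)
  reassoc = solve 3 (λ x y z → x :* y :* z := y :* (x :* z)) refl
  split : ∀ k → w′ (suc k) * f (suc k) ≡ A (suc k) + B k
  split k = trans (cong (_* f (suc k)) (w′-suc k))
    (solve 5 (λ a w b v x → (a :* w :+ b :* v) :* x := w :* (a :* x) :+ v :* (b :* x)) refl
       (a (suc k)) (w (suc k)) (b k) (w k) (f (suc k)))
  A-top : A (suc n) ≡ 0ℚ
  A-top = trans (cong (_* (a (suc n) * f (suc n))) w-top) (*-zeroˡ (a (suc n) * f (suc n)))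
  factor : ∀ k → A k + B k ≡ w k * (a k * f k + b k * f (suc k))
  factor k = solve 3 (λ w x y → w :* x :+ w :* y := w :* (x :+ y)) refl (w k) (a k * f k) (b k * f (suc k))

n<k⇒Snk≡0 : ∀ {n k} → n ℕ.< k → S n k ≡ 0
n<k⇒Snk≡0 {zero}  {suc k} _         = refl
n<k⇒Snk≡0 {suc n} {suc k} (s≤s n<k) = trans
  (cong₂ (λ a b → suc k ℕ.* a ℕ.+ b) (n<k⇒Snk≡0 (ℕ.m<n⇒m<1+n n<k)) (n<k⇒Snk≡0 n<k))
  (cong (ℕ._+ 0) (ℕ.*-zeroʳ (suc k)))

surjections : ℕ → ℕ → ℚ
surjections n k = ι (S n k) * ι (k !)

surjections-zero : ∀ n → surjections n 0 ≡ δ₀ n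
surjections-zero zero    = refl
surjections-zero (suc n) = refl

surjections-suc : ∀ n k →
  surjections (suc n) (suc k) ≡ ι (suc k) * surjections n (suc k) + ι (suc k) * surjections n k
surjections-suc n k = begin
  ι (suc k ℕ.* S n (suc k) ℕ.+ S n k) * ι (suc k ℕ.* k !)
    ≡⟨ cong₂ _*_ (trans (ι-+ (suc k ℕ.* S n (suc k)) (S n k)) (cong (_+ ι (S n k)) (ι-* (suc k) (S n (suc k)))))
                 (ι-* (suc k) (k !)) ⟩
  (K * ι (S n (suc k)) + ι (S n k)) * (K * ι (k !))
    ≡⟨ solve 4 (λ K a b f → (K :* a :+ b) :* (K :* f) := K :* (a :* (K :* f)) :+ K :* (b :* f)) refl
         K (ι (S n (suc k))) (ι (S n k)) (ι (k !)) ⟩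
  K * (ι (S n (suc k)) * (K * ι (k !))) + K * surjections n k
    ≡⟨ cong (λ x → K * (ι (S n (suc k)) * x) + K * surjections n k) (ι-* (suc k) (k !)) ⟨
  K * surjections n (suc k) + K * surjections n k ∎
  where
  open ≡-Reasoning
  K : ℚ
  K = ι (suc k)

stirling : ℕ → (ℕ → ℚ) → ℚ
stirling n = weightedSum (surjections n) n

stirlingStep : (ℕ → ℚ) → ℕ → ℚ
stirlingStep f k = ι k * f k + ι (suc k) * f (suc k)

stirling-suc : ∀ n f → stirling (suc n) f ≡ stirling n (stirlingStep f)
stirling-suc n f = weightedSum-pascal n ι (λ k → ι (suc k)) (surjections n) (surjections (suc n)) f
  (sym (*-zeroˡ (surjections n 0))) (surjections-suc n)
  (trans (cong (λ s → ι s * ι (suc n !)) (n<k⇒Snk≡0 (ℕ.n<1+n n))) (*-zeroˡ (ι (suc n !))))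

stirling-δ₀ : ∀ n → stirling n δ₀ ≡ δ₀ n
stirling-δ₀ n = trans (weightedSum-δ₀ (surjections n) n) (surjections-zero n)

stirlingStep-sign : ∀ k → stirlingStep sign k ≡ - sign k
stirlingStep-sign k = trans (cong (λ x → ι k * sign k + x * (- sign k)) (ι-suc k))
  (solve 2 (λ x s → x :* s :+ (con 1ℚ :+ x) :* (:- s) := :- s) refl (ι k) (sign k))

stirling-sign : ∀ n → stirling n sign ≡ sign n
stirling-sign zero    = refl
stirling-sign (suc n) = begin
  stirling (suc n) sign           ≡⟨ stirling-suc n sign ⟩
  stirling n (stirlingStep sign)  ≡⟨ weightedSum-cong (surjections n) n stirlingStep-sign ⟩
  stirling n (λ k → - sign k)     ≡⟨ weightedSum-neg (surjections n) n sign ⟩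
  - stirling n sign               ≡⟨ cong -_ (stirling-sign n) ⟩
  - sign n                        ∎
  where open ≡-Reasoning

stirlingStep-signH : ∀ k → stirlingStep (λ j → sign j * H j) k ≡ - (sign k * H k) + - sign k
stirlingStep-signH k = begin
  ι k * (s * H k) + ι (suc k) * (- s * (H k + q))
    ≡⟨ cong (λ K → ι k * (s * H k) + K * (- s * (H k + q))) (ι-suc k) ⟩
  ι k * (s * H k) + (1ℚ + ι k) * (- s * (H k + q))
    ≡⟨ solve 4 (λ x s h q → x :* (s :* h) :+ (con 1ℚ :+ x) :* ((:- s) :* (h :+ q))
                          := :- (s :* h) :+ :- (s :* ((con 1ℚ :+ x) :* q))) refl (ι k) s (H k) q ⟩
  - (s * H k) + - (s * ((1ℚ + ι k) * q))
    ≡⟨ cong (λ x → - (s * H k) + - (s * (x * q))) (ι-suc k) ⟨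
  - (s * H k) + - (s * (ι (suc k) * q))
    ≡⟨ cong (λ x → - (s * H k) + - (s * x)) (ι-suc-inverseʳ k) ⟩
  - (s * H k) + - (s * 1ℚ)
    ≡⟨ cong (λ x → - (s * H k) + - x) (*-identityʳ s) ⟩
  - (s * H k) + - s ∎
  where
  open ≡-Reasoning
  s : ℚ
  s = sign k
  q : ℚ
  q = ℤ.+ 1 / suc k

-- For k ≥ 1 the two steps agree: kHₖ₋₁ - (k+1)Hₖ and kHₖ - (k+1)Hₖ₊₁ both equal -Hₖ - 1.
stirlingStep-signη : ∀ k → stirlingStep (λ j → sign j * η j) k ≡ stirlingStep (λ j → sign j * H j) k + δ₀ k
stirlingStep-signη zero    = refl
stirlingStep-signη (suc k) = begin
  K * (- s * H k) + ι (suc (suc k)) * (- - s * (H k + q))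
    ≡⟨ cong (λ x → K * (- s * H k) + x * (- - s * (H k + q))) (ι-suc (suc k)) ⟩
  K * (- s * H k) + (1ℚ + K) * (- - s * (H k + q))
    ≡⟨ solve 4 (λ K s h q → K :* ((:- s) :* h) :+ (con 1ℚ :+ K) :* ((:- (:- s)) :* (h :+ q))
                          := s :* (h :+ q) :+ s :* (K :* q)) refl K s (H k) q ⟩
  s * (H k + q) + s * (K * q)
    ≡⟨ cong (λ x → s * (H k + q) + s * x) (ι-suc-inverseʳ k) ⟩
  s * (H k + q) + s * 1ℚ
    ≡⟨ solve 3 (λ s h q → s :* (h :+ q) :+ s :* con 1ℚ := :- ((:- s) :* (h :+ q)) :+ :- (:- s) :+ con 0ℚ)
         refl s (H k) q ⟩
  - (sign (suc k) * H (suc k)) + - sign (suc k) + 0ℚ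
    ≡⟨ cong (_+ 0ℚ) (stirlingStep-signH (suc k)) ⟨
  stirlingStep (λ j → sign j * H j) (suc k) + 0ℚ ∎
  where
  open ≡-Reasoning
  s : ℚ
  s = sign k
  q : ℚ
  q = ℤ.+ 1 / suc k
  K : ℚ
  K = ι (suc k)

stirling-signH : ∀ n → stirling n (λ k → sign k * H k) ≡ sign n * ι n
stirling-signH zero    = refl
stirling-signH (suc n) = begin
  stirling (suc n) u                                   ≡⟨ stirling-suc n u ⟩
  stirling n (stirlingStep u)                          ≡⟨ weightedSum-cong w n stirlingStep-signH ⟩
  stirling n (λ k → - u k + - sign k)                  ≡⟨ weightedSum-+ w n _ _ ⟩
  stirling n (λ k → - u k) + stirling n (λ k → - sign k)
    ≡⟨ cong₂ _+_ (weightedSum-neg w n u) (weightedSum-neg w n sign) ⟩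
  - stirling n u + - stirling n sign                   ≡⟨ cong₂ (λ a b → - a + - b) (stirling-signH n) (stirling-sign n) ⟩
  - (sign n * ι n) + - sign n
    ≡⟨ solve 2 (λ s x → :- (s :* x) :+ :- s := (:- s) :* (con 1ℚ :+ x)) refl (sign n) (ι n) ⟩
  - sign n * (1ℚ + ι n)                                ≡⟨ cong (- sign n *_) (ι-suc n) ⟨
  sign (suc n) * ι (suc n)                             ∎
  where
  open ≡-Reasoning
  u : ℕ → ℚ
  u k = sign k * H k
  w : ℕ → ℚ
  w = surjections n

δ₀≡δ₁∘suc : ∀ n → δ₀ n ≡ δ₁ (suc n)
δ₀≡δ₁∘suc zero    = refl
δ₀≡δ₁∘suc (suc n) = refl

stirling-signη : ∀ n → stirling n (λ k → sign k * η k) ≡ sign n * ι n + δ₁ n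
stirling-signη zero    = refl
stirling-signη (suc n) = begin
  stirling (suc n) (λ k → sign k * η k)                ≡⟨ stirling-suc n _ ⟩
  stirling n (stirlingStep (λ k → sign k * η k))       ≡⟨ weightedSum-cong w n stirlingStep-signη ⟩
  stirling n (λ k → stirlingStep u k + δ₀ k)           ≡⟨ weightedSum-+ w n (stirlingStep u) δ₀ ⟩
  stirling n (stirlingStep u) + stirling n δ₀          ≡⟨ cong₂ _+_ (sym (stirling-suc n u)) (stirling-δ₀ n) ⟩
  stirling (suc n) u + δ₀ n                            ≡⟨ cong₂ _+_ (stirling-signH (suc n)) (δ₀≡δ₁∘suc n) ⟩
  sign (suc n) * ι (suc n) + δ₁ (suc n)                ∎
  where
  open ≡-Reasoning
  u : ℕ → ℚ
  u k = sign k * H k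
  w : ℕ → ℚ
  w = surjections n

𝓔η-closed : ∀ n → 𝓔η n ≡ sign n * ι n + δ₁ n
𝓔η-closed n = trans
  (sumTo-cong n (λ k → solve 4 (λ a s f e → a :* s :* f :* e := a :* f :* (s :* e)) refl
                        (ι (S n k)) (sign k) (ι (k !)) (η k)))
  (stirling-signη n)

binomial : ℕ → (ℕ → ℚ) → ℚ
binomial N = weightedSum (λ k → ι (N C k)) N

binomialStep : (ℕ → ℚ) → ℕ → ℚ
binomialStep f k = f k + f (suc k)

binomial-suc : ∀ N f → binomial (suc N) f ≡ binomial N (binomialStep f)
binomial-suc N f = trans
  (weightedSum-pascal N (λ _ → 1ℚ) (λ _ → 1ℚ) (λ k → ι (N C k)) (λ k → ι (suc N C k)) f refl pascal
    (cong ι (k>n⇒nCk≡0 (ℕ.n<1+n N))))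
  (weightedSum-cong (λ k → ι (N C k)) N (λ k → cong₂ _+_ (*-identityˡ (f k)) (*-identityˡ (f (suc k)))))
  where
  pascal : ∀ k → ι (suc N C suc k) ≡ 1ℚ * ι (N C suc k) + 1ℚ * ι (N C k)
  pascal k = trans (cong ι (sym (nCk+nC[k+1]≡[n+1]C[k+1] N k))) (trans (ι-+ (N C k) (N C suc k))
    (solve 2 (λ a b → a :+ b := con 1ℚ :* b :+ con 1ℚ :* a) refl (ι (N C k)) (ι (N C suc k))))

binomial-2ⁿsign : ∀ N → binomial N (λ n → ι (2 ^ n) * sign n) ≡ sign N
binomial-2ⁿsign zero    = refl
binomial-2ⁿsign (suc N) = begin
  binomial (suc N) b                  ≡⟨ binomial-suc N b ⟩
  binomial N (binomialStep b)         ≡⟨ weightedSum-cong (λ k → ι (N C k)) N step ⟩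
  binomial N (λ n → - b n)            ≡⟨ weightedSum-neg (λ k → ι (N C k)) N b ⟩
  - binomial N b                      ≡⟨ cong -_ (binomial-2ⁿsign N) ⟩
  - sign N                            ∎
  where
  open ≡-Reasoning
  b : ℕ → ℚ
  b n = ι (2 ^ n) * sign n
  step : ∀ n → binomialStep b n ≡ - b n
  step n = trans (cong (λ P → b n + P * - sign n) (ι-* 2 (2 ^ n)))
    (solve 2 (λ P s → P :* s :+ con (ι 2) :* P :* (:- s) := :- (P :* s)) refl (ι (2 ^ n)) (sign n))

binomial-2ⁿsignι : ∀ N → binomial N (λ n → ι (2 ^ n) * (sign n * ι n)) ≡ sign N * (ι 2 * ι N)
binomial-2ⁿsignι zero    = refl
binomial-2ⁿsignι (suc N) = begin
  binomial (suc N) a                                    ≡⟨ binomial-suc N a ⟩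
  binomial N (binomialStep a)                           ≡⟨ weightedSum-cong w N step ⟩
  binomial N (λ n → - a n + - (ι 2 * b n))              ≡⟨ weightedSum-+ w N _ _ ⟩
  binomial N (λ n → - a n) + binomial N (λ n → - (ι 2 * b n))
    ≡⟨ cong₂ _+_ (weightedSum-neg w N a) (trans (weightedSum-neg w N _) (cong -_ (weightedSum-scale w N (ι 2) b))) ⟩
  - binomial N a + - (ι 2 * binomial N b)               ≡⟨ cong₂ (λ x y → - x + - (ι 2 * y)) (binomial-2ⁿsignι N) (binomial-2ⁿsign N) ⟩
  - (sign N * (ι 2 * ι N)) + - (ι 2 * sign N)
    ≡⟨ solve 2 (λ s x → :- (s :* (con (ι 2) :* x)) :+ :- (con (ι 2) :* s) := (:- s) :* (con (ι 2) :* (con 1ℚ :+ x)))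
         refl (sign N) (ι N) ⟩
  - sign N * (ι 2 * (1ℚ + ι N))                         ≡⟨ cong (λ x → - sign N * (ι 2 * x)) (ι-suc N) ⟨
  sign (suc N) * (ι 2 * ι (suc N))                      ∎
  where
  open ≡-Reasoning
  w : ℕ → ℚ
  w k = ι (N C k)
  a : ℕ → ℚ
  a n = ι (2 ^ n) * (sign n * ι n)
  b : ℕ → ℚ
  b n = ι (2 ^ n) * sign n
  step : ∀ n → binomialStep a n ≡ - a n + - (ι 2 * b n)
  step n = trans (cong₂ (λ P x → a n + P * (- sign n * x)) (ι-* 2 (2 ^ n)) (ι-suc n))
    (solve 3 (λ P s x → P :* (s :* x) :+ con (ι 2) :* P :* ((:- s) :* (con 1ℚ :+ x))
                      := :- (P :* (s :* x)) :+ :- (con (ι 2) :* (P :* s))) refl (ι (2 ^ n)) (sign n) (ι n))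

binomial₂ : ℕ → (ℕ → ℚ) → ℚ
binomial₂ N = weightedSum (λ n → ι (N C n) * ι (2 ^ n)) N

binomial₂≡binomial : ∀ N f → binomial₂ N f ≡ binomial N (λ n → ι (2 ^ n) * f n)
binomial₂≡binomial N f =
  sumTo-cong N (λ n → *-assoc (ι (N C n)) (ι (2 ^ n)) (f n))

binomial₂-δ₁ : ∀ N → binomial₂ N δ₁ ≡ ι (2 ℕ.* N)
binomial₂-δ₁ zero    = refl
binomial₂-δ₁ (suc N) = begin
  binomial₂ (suc N) δ₁         ≡⟨ weightedSum-δ₁ (λ n → ι (suc N C n) * ι (2 ^ n)) N ⟩
  ι (suc N C 1) * ι 2          ≡⟨ cong (λ m → ι m * ι 2) (nC1≡n (suc N)) ⟩
  ι (suc N) * ι 2              ≡⟨ *-comm (ι (suc N)) (ι 2) ⟩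
  ι 2 * ι (suc N)              ≡⟨ ι-* 2 (suc N) ⟨
  ι (2 ℕ.* suc N)              ∎
  where open ≡-Reasoning

binomial₂-signι : ∀ N → binomial₂ N (λ n → sign n * ι n) ≡ ι (2 ℕ.* N) * sign N
binomial₂-signι N = begin
  binomial₂ N (λ n → sign n * ι n)                      ≡⟨ binomial₂≡binomial N _ ⟩
  binomial N (λ n → ι (2 ^ n) * (sign n * ι n))         ≡⟨ binomial-2ⁿsignι N ⟩
  sign N * (ι 2 * ι N)                                  ≡⟨ cong (sign N *_) (ι-* 2 N) ⟨
  sign N * ι (2 ℕ.* N)                                  ≡⟨ *-comm (sign N) (ι (2 ℕ.* N)) ⟩
  ι (2 ℕ.* N) * sign N                                  ∎
  where open ≡-Reasoning

binomial₂-𝓔η : ∀ N → binomial₂ N 𝓔η ≡ ι (2 ℕ.* N) * (1ℚ + sign N)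
binomial₂-𝓔η N = begin
  binomial₂ N 𝓔η                                        ≡⟨ weightedSum-cong w N 𝓔η-closed ⟩
  binomial₂ N (λ n → sign n * ι n + δ₁ n)               ≡⟨ weightedSum-+ w N _ δ₁ ⟩
  binomial₂ N (λ n → sign n * ι n) + binomial₂ N δ₁     ≡⟨ cong₂ _+_ (binomial₂-signι N) (binomial₂-δ₁ N) ⟩
  ι (2 ℕ.* N) * sign N + ι (2 ℕ.* N)
    ≡⟨ solve 2 (λ x s → x :* s :+ x := x :* (con 1ℚ :+ s)) refl (ι (2 ℕ.* N)) (sign N) ⟩
  ι (2 ℕ.* N) * (1ℚ + sign N)                           ∎
  where
  open ≡-Reasoning
  w : ℕ → ℚ
  w n = ι (N C n) * ι (2 ^ n)

lemma10 : ((n : ℕ) → 𝓔η n ≡ sign n * ι n + δ₁ n)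
    × ((N : ℕ) → sumTo N (λ n → ι (N C n) * ι (2 ^ n) * 𝓔η n) ≡ ι (2 ℕ.* N) * (1ℚ + sign N))
lemma10 = 𝓔η-closed , binomial₂-𝓔η
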